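{- Let $\alpha=\{B_1^{p_1},\dots,B_l^{p_l}\}\in\Pi_n^\bullet$ with $\min B_1<\cdots<\min B_l$, and let $U(\alpha)=\{\pi\in\Pi_n^\bullet:\pi\ge\alpha\}$. Define $\Phi:U(\alpha)\to\Pi^\bullet_{\{\min B_1,\dots,\min B_l\}}$ as follows: for a pointed set $A^q$ with $A=B_{j_1}\cup\cdots\cup B_{j_r}$, $j_1<\cdots<j_r$, and $q=p_{j_s}$ for some $s\in[r]$, set $\Phi(A^q)=\{\min B_{j_1},\dots,\min B_{j_r}\}^{\min B_{j_s}}$, and for $\pi\in U(\alpha)$ set $\Phi(\pi)=\{\Phi(A^q):A^q\in\pi\}$. Then $\Phi$ is a poset isomorphism and it preserves the labeling $\lambda_\bullet$: for every cover $\pi\lessdot\pi'$ in $U(\alpha)$, $\lambda_\bullet(\Phi(\pi)\lessdot\Phi(\pi'))=\lambda_\bullet(\pi\lessdot\pi')$.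
   Context: For a finite set $S\subset\mathbb{N}$, a pointed set is a pair $(A,p)$, written $A^p$, with $A$ nonempty and $p\in A$; a pointed partition of $S$ is a collection of pointed sets whose underlying sets form a set partition of $S$. The poset $\Pi_S^\bullet$ (and $\Pi_n^\bullet=\Pi_{[n]}^\bullet$) has $\pi\lessdot\pi'$ exactly when $\pi'$ is obtained from $\pi$ by replacing two blocks $A^p,B^q$ (with $\min A<\min B$) by $(A\cup B)^p$ (a $1$-merge) or $(A\cup B)^q$ (a $0$-merge), other blocks unchanged. The labeling $\lambda_\bullet$ assigns to a cover obtained by a $u$-merge of $A^p$ and $B^q$ the label $(\min A,\min B)^u$. -}

module Defs where

open import Data.Nat using (ℕ)
open import Data.Bool using (Bool; true; false; if_then_else_)
open import Data.Fin using (Fin; zero; suc; _<_; _≤_; _≟_)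
open import Data.Fin.Subset using (Subset; _∈_; _∪_; ⁅_⁆; inside; outside) renaming (⊥ to ∅)
open import Data.Fin.Subset.Properties using (_⊆?_)
open import Data.Maybe using (Maybe; just; nothing)
import Data.Maybe as Maybe
open import Data.Product using (Σ; _×_; _,_; proj₁; proj₂)
open import Data.Sum using (_⊎_)
open import Data.Empty using (⊥)
open import Data.Unit using (⊤)
open import Data.List using (List; []; _∷_; map; foldr)
import Data.List.Membership.Propositional as LM
open import Data.Vec using ([]; _∷_)
open import Relation.Nullary using (¬_; yes; no)
open import Relation.Binary.PropositionalEquality using (_≡_; _≢_)
open import Relation.Binary.Construct.Closure.ReflexiveTransitive using (Star)
open import Function.Bundles using (_⇔_)

-- Ground set [n] is modelled by Fin n (0-indexed; order-preserving shift).
-- A pointed set A^p : underlying subset A together with its point p.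
PSet : ℕ → Set
PSet n = Subset n × Fin n

Raw : ℕ → Set
Raw n = List (PSet n)

_∈L_ : ∀ {n} → PSet n → Raw n → Set
X ∈L L = X LM.∈ L

_≈_ : ∀ {n} → Raw n → Raw n → Set
L ≈ L' = ∀ X → (X ∈L L) ⇔ (X ∈L L')

record IsPP {n : ℕ} (S : Fin n → Set) (L : Raw n) : Set where
  field
    point∈ : ∀ {A p} → (A , p) ∈L L → p ∈ A
    disjoint : ∀ {X Y} → X ∈L L → Y ∈L L → X ≢ Y →
               ∀ x → x ∈ proj₁ X → x ∈ proj₁ Y → ⊥
    union : ∀ x → S x ⇔ Σ (PSet n) (λ X → X ∈L L × x ∈ proj₁ X)

Full : ∀ {n} → Fin n → Set
Full _ = ⊤

IsMin : ∀ {n} → Fin n → Subset n → Set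
IsMin a A = a ∈ A × (∀ x → x ∈ A → a ≤ x)

-- L' is obtained from L by a u-merge of blocks A^p, B^q with min A = a < b = min B.
-- u = true : 1-merge (point p kept); u = false : 0-merge (point q kept).
Merge : ∀ {n} → Raw n → Raw n → Fin n → Fin n → Bool → Set
Merge {n} L L' a b u =
  Σ (Subset n) λ A → Σ (Fin n) λ p → Σ (Subset n) λ B → Σ (Fin n) λ q →
    (A , p) ∈L L × (B , q) ∈L L × IsMin a A × IsMin b B × a < b ×
    (∀ X → (X ∈L L') ⇔
       ((X ∈L L × X ≢ (A , p) × X ≢ (B , q)) ⊎
        X ≡ (A ∪ B , (if u then p else q))))

-- Covering relation π ⋖ π' (labelled by (a , b)^u).
Cover : ∀ {n} → Raw n → Raw n → Set
Cover {n} L L' = Σ (Fin n) λ a → Σ (Fin n) λ b → Σ Bool λ u → Merge L L' a b u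

_≤P_ : ∀ {n} → Raw n → Raw n → Set
L ≤P L' = Σ (Raw _) λ L'' → Star Cover L L'' × L'' ≈ L'

MinsOf : ∀ {n} → Raw n → Fin n → Set
MinsOf α x = Σ (PSet _) λ X → X ∈L α × IsMin x (proj₁ X)

firstIn : ∀ {n} → Subset n → Maybe (Fin n)
firstIn [] = nothing
firstIn (true ∷ v) = just zero
firstIn (false ∷ v) = Maybe.map suc (firstIn v)

maybeSingleton : ∀ {n} → Maybe (Fin n) → Subset n
maybeSingleton nothing = ∅
maybeSingleton (just x) = ⁅ x ⁆

-- Φ on the underlying set A: {min B_j : B_j ∈ α, B_j ⊆ A}
-- (for π ≥ α, these B_j are exactly those with A = B_{j1} ∪ … ∪ B_{jr}).
ΦSet : ∀ {n} → Raw n → Subset n → Subset n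
ΦSet α A = foldr step ∅ α
  where
  step : PSet _ → Subset _ → Subset _
  step (B , _) acc with B ⊆? A
  ... | yes _ = maybeSingleton (firstIn B) ∪ acc
  ... | no _  = acc

-- Φ on the point q = p_s : min B_s (where B_s^{p_s} ∈ α); default q if none.
ΦPoint : ∀ {n} → Raw n → Fin n → Fin n
ΦPoint [] q = q
ΦPoint ((B , p) ∷ α) q with p ≟ q | firstIn B
... | yes _ | just m = m
... | _     | _      = ΦPoint α q

ΦBlock : ∀ {n} → Raw n → PSet n → PSet n
ΦBlock α (A , q) = ΦSet α A , ΦPoint α q

Φ : ∀ {n} → Raw n → Raw n → Raw n
Φ α π = map (ΦBlock α) π

-- Between pointed partitions of the same set, π ≤ π′ holds exactly when π′ is coarser as a
-- pointed partition: every block of π′ contains the block of π with the same point, and every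
-- block of π lies in a block of π′.  (Given such a π′ ≠ π, merging two blocks of π inside one
-- block of π′, keeping the point of the π′-block, is a cover that stays below π′.)  Above α every
-- block is a union of blocks of α, so it is recovered from the set of their minima and its point
-- from the minimum of the α-block carrying it.  Hence Φ is injective on blocks, commutes with
-- unions of such blocks and preserves minima; it therefore preserves and reflects coarsening and
-- sends each merge to the merge with the same label.  Replacing every minimum by its α-block
-- inverts Φ.
module Submission where

open import Defs
open import Data.Nat using (ℕ; zero; suc; s≤s; z≤n) renaming (_≤_ to _≤ℕ_; _<_ to _<ℕ_)
import Data.Nat.Properties as ℕₚ
open import Data.Bool using (Bool; true; false; if_then_else_)
import Data.Bool.Properties as Boolₚ
open import Data.Fin using (Fin; zero; suc; _<_; _≤_; _≟_)
import Data.Fin.Properties as Finₚ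
open import Data.Fin.Subset using (Subset; _∈_; _∉_; _∪_; _⊆_) renaming (⊥ to ∅)
open import Data.Fin.Subset.Properties
open import Data.Maybe using (just; nothing)
open import Data.Maybe.Properties using (just-injective)
open import Data.Product using (Σ; ∃; _×_; _,_; proj₁; proj₂)
open import Data.Product.Properties using (≡-dec)
open import Data.Sum using (_⊎_; inj₁; inj₂)
open import Data.Empty using (⊥; ⊥-elim)
open import Data.Unit using (tt)
open import Data.Vec using (_∷_; here; there)
import Data.Vec.Properties as Vecₚ
open import Data.List using ([]; _∷_; filter; length; map)
open import Data.List.Properties using (filter-notAll)
open import Data.List.Relation.Unary.Any using (any?; here; there)
import Data.List.Relation.Unary.Any as Any
open import Data.List.Membership.Propositional using (find; lose)
open import Data.List.Membership.Propositional.Properties using (∈-filter⁺; ∈-filter⁻; ∈-map⁺; ∈-map⁻)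
import Data.List.Membership.DecPropositional as DecMembership
open import Relation.Nullary using (¬_; Dec; yes; no)
open import Relation.Nullary.Decidable using (¬?; _→-dec_)
open import Relation.Binary.Definitions using (tri<; tri>; tri≈)
open import Relation.Binary.PropositionalEquality
open import Relation.Binary.Construct.Closure.ReflexiveTransitive using (Star; ε; _◅_)
open import Function.Bundles using (_⇔_; mk⇔; Equivalence)

open Equivalence using (to; from)
open import Function.Properties.Equivalence using () renaming (sym to ⇔-sym)

_≟ᵖ_ : ∀ {n} (X Y : PSet n) → Dec (X ≡ Y)
_≟ᵖ_ = ≡-dec (Vecₚ.≡-dec Boolₚ._≟_) _≟_

_∈L?_ : ∀ {n} (X : PSet n) (L : Raw n) → Dec (X ∈L L)
X ∈L? L = DecMembership._∈?_ _≟ᵖ_ X L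

⊈⇒∃∉ : ∀ {n} {C A : Subset n} → ¬ (C ⊆ A) → ∃ λ x → x ∈ C × x ∉ A
⊈⇒∃∉ {n} {C} {A} C⊈A
  with Finₚ.¬∀⟶∃¬ n (λ i → i ∈ C → i ∈ A) (λ i → (i ∈? C) →-dec (i ∈? A)) (λ f → C⊈A (f _))
... | x , ¬x∈C⇒x∈A with x ∈? C
...   | yes x∈C = x , x∈C , λ x∈A → ¬x∈C⇒x∈A (λ _ → x∈A)
...   | no x∉C = ⊥-elim (¬x∈C⇒x∈A (λ x∈C → ⊥-elim (x∉C x∈C)))

firstIn-∈ : ∀ {n} {B : Subset n} {m} → firstIn B ≡ just m → m ∈ B
firstIn-∈ {B = true ∷ B} refl = here
firstIn-∈ {B = false ∷ B} eq with firstIn B in e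
firstIn-∈ {B = false ∷ B} refl | just k = there (firstIn-∈ e)

firstIn-minimal : ∀ {n} {B : Subset n} {m} → firstIn B ≡ just m → ∀ {x} → x ∈ B → m ≤ x
firstIn-minimal {B = true ∷ B} refl x∈B = z≤n
firstIn-minimal {B = false ∷ B} eq x∈B with firstIn B in e
firstIn-minimal {B = false ∷ B} refl (there x∈B) | just k = s≤s (firstIn-minimal e x∈B)

firstIn-nonempty : ∀ {n} {B : Subset n} {x} → x ∈ B → ∃ λ m → firstIn B ≡ just m
firstIn-nonempty {B = true ∷ B} x∈B = zero , refl
firstIn-nonempty {B = false ∷ B} (there x∈B) with firstIn-nonempty x∈B
... | m , e rewrite e = suc m , refl

firstIn⇒IsMin : ∀ {n} {B : Subset n} {m} → firstIn B ≡ just m → IsMin m B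
firstIn⇒IsMin e = firstIn-∈ e , λ x x∈B → firstIn-minimal e x∈B

IsMin⇒firstIn : ∀ {n} {B : Subset n} {m} → IsMin m B → firstIn B ≡ just m
IsMin⇒firstIn (m∈B , m≤) with firstIn-nonempty m∈B
... | k , e = trans e (cong just (Finₚ.≤-antisym (firstIn-minimal e m∈B) (m≤ _ (firstIn-∈ e))))

same-block : ∀ {n} {S : Fin n → Set} {L : Raw n} → IsPP S L →
             ∀ {X Y x} → X ∈L L → Y ∈L L → x ∈ proj₁ X → x ∈ proj₁ Y → X ≡ Y
same-block pp {X} {Y} {x} X∈ Y∈ x∈X x∈Y with X ≟ᵖ Y
... | yes X≡Y = X≡Y
... | no X≢Y = ⊥-elim (IsPP.disjoint pp X∈ Y∈ X≢Y x x∈X x∈Y)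

-- The order of pointed partitions as coarsening

infix 4 _⊑_

_⊑_ : ∀ {n} → Raw n → Raw n → Set
L ⊑ L′ = (∀ {A q} → (A , q) ∈L L′ → ∃ λ B → (B , q) ∈L L × B ⊆ A) ×
               (∀ {X} → X ∈L L → ∃ λ Y → Y ∈L L′ × proj₁ X ⊆ proj₁ Y)

≈-sym : ∀ {n} {L L′ : Raw n} → L ≈ L′ → L′ ≈ L
≈-sym L≈L′ X = ⇔-sym (L≈L′ X)

⊑-refl : ∀ {n} {L : Raw n} → L ⊑ L
⊑-refl = (λ {A} A∈ → A , A∈ , ⊆-refl) , λ {X} X∈ → X , X∈ , ⊆-refl

⊑-trans : ∀ {n} {L M N : Raw n} → L ⊑ M → M ⊑ N → L ⊑ N
⊑-trans (blockBelow₁ , blockAbove₁) (blockBelow₂ , blockAbove₂) =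
  (λ A∈ → let B , B∈ , B⊆ = blockBelow₂ A∈ ; B′ , B′∈ , B′⊆ = blockBelow₁ B∈
          in B′ , B′∈ , ⊆-trans B′⊆ B⊆) ,
  (λ X∈ → let Y , Y∈ , X⊆ = blockAbove₁ X∈ ; Z , Z∈ , Y⊆ = blockAbove₂ Y∈
          in Z , Z∈ , ⊆-trans X⊆ Y⊆)

⊑-respʳ-≈ : ∀ {n} {L M N : Raw n} → L ⊑ M → M ≈ N → L ⊑ N
⊑-respʳ-≈ (blockBelow , blockAbove) M≈N =
  (λ A∈ → blockBelow (from (M≈N _) A∈)) ,
  (λ X∈ → let Y , Y∈ , X⊆ = blockAbove X∈ in Y , to (M≈N _) Y∈ , X⊆)

Merge⇒⊑ : ∀ {n} {L L′ : Raw n} {a b u} → Merge L L′ a b u → L ⊑ L′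
Merge⇒⊑ {L = L} {L′} {u = u} (A , p , B , q , A∈ , B∈ , _ , _ , _ , L′≡) = blockBelow , blockAbove
  where
  mergedBlockBelow : ∀ v {C s} → (C , s) ≡ (A ∪ B , (if v then p else q)) →
                     ∃ λ D → (D , s) ∈L L × D ⊆ C
  mergedBlockBelow true refl = A , A∈ , p⊆p∪q B
  mergedBlockBelow false refl = B , B∈ , q⊆p∪q A B

  blockBelow : ∀ {C s} → (C , s) ∈L L′ → ∃ λ D → (D , s) ∈L L × D ⊆ C
  blockBelow {C} C∈ with to (L′≡ _) C∈
  ... | inj₁ (C∈L , _) = C , C∈L , ⊆-refl
  ... | inj₂ C≡ = mergedBlockBelow u C≡

  merged∈ : (A ∪ B , (if u then p else q)) ∈L L′
  merged∈ = from (L′≡ _) (inj₂ refl)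

  blockAbove : ∀ {X} → X ∈L L → ∃ λ Y → Y ∈L L′ × proj₁ X ⊆ proj₁ Y
  blockAbove {X} X∈ with X ≟ᵖ (A , p) | X ≟ᵖ (B , q)
  ... | yes refl | _ = _ , merged∈ , p⊆p∪q B
  ... | no _ | yes refl = _ , merged∈ , q⊆p∪q A B
  ... | no X≢A | no X≢B = X , from (L′≡ _) (inj₁ (X∈ , X≢A , X≢B)) , ⊆-refl

≤P⇒⊑ : ∀ {n} {L L′ : Raw n} → L ≤P L′ → L ⊑ L′
≤P⇒⊑ (L″ , chain , L″≈L′) = ⊑-respʳ-≈ (Star⇒⊑ chain) L″≈L′
  where
  Star⇒⊑ : ∀ {X Y} → Star Cover X Y → X ⊑ Y
  Star⇒⊑ ε = ⊑-refl
  Star⇒⊑ ((_ , _ , _ , m) ◅ chain) = ⊑-trans (Merge⇒⊑ m) (Star⇒⊑ chain)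

remove : ∀ {n} → PSet n → Raw n → Raw n
remove X = filter (λ Y → ¬? (Y ≟ᵖ X))

∈-remove⁻ : ∀ {n} {X Y : PSet n} {L} → Y ∈L remove X L → Y ∈L L × Y ≢ X
∈-remove⁻ {X = X} = ∈-filter⁻ (λ Y → ¬? (Y ≟ᵖ X))

∈-remove⁺ : ∀ {n} {X Y : PSet n} {L} → Y ∈L L → Y ≢ X → Y ∈L remove X L
∈-remove⁺ {X = X} = ∈-filter⁺ (λ Y → ¬? (Y ≟ᵖ X))

remove-shorter : ∀ {n} {X : PSet n} {L} → X ∈L L → length (remove X L) <ℕ length L
remove-shorter {X = X} {L} X∈ = filter-notAll (λ Y → ¬? (Y ≟ᵖ X)) L (Any.map (λ Y≡X Y≢X → Y≢X (sym Y≡X)) X∈)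

module Merged {n} {S : Fin n → Set} {π : Raw n} (pp : IsPP S π) {A p B q a b} (u : Bool)
              (A∈ : (A , p) ∈L π) (B∈ : (B , q) ∈L π) (A≢B : (A , p) ≢ (B , q))
              (minA : firstIn A ≡ just a) (minB : firstIn B ≡ just b) (a<b : a < b) where
  open IsPP

  rest : Raw n
  rest = remove (B , q) (remove (A , p) π)

  merged : Raw n
  merged = (A ∪ B , (if u then p else q)) ∷ rest

  ∈-rest⁻ : ∀ {Y} → Y ∈L rest → Y ∈L π × Y ≢ (A , p) × Y ≢ (B , q)
  ∈-rest⁻ Y∈ = let Y∈′ , Y≢B = ∈-remove⁻ Y∈ ; Y∈π , Y≢A = ∈-remove⁻ Y∈′ in Y∈π , Y≢A , Y≢B

  ∈-rest⁺ : ∀ {Y} → Y ∈L π → Y ≢ (A , p) → Y ≢ (B , q) → Y ∈L rest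
  ∈-rest⁺ Y∈ Y≢A Y≢B = ∈-remove⁺ (∈-remove⁺ Y∈ Y≢A) Y≢B

  merged-shorter : length merged <ℕ length π
  merged-shorter = ℕₚ.≤-trans (s≤s (remove-shorter (∈-remove⁺ B∈ (λ B≡A → A≢B (sym B≡A)))))
                              (remove-shorter A∈)

  merged-cover : Cover π merged
  merged-cover = a , b , u , A , p , B , q , A∈ , B∈ , firstIn⇒IsMin minA , firstIn⇒IsMin minB , a<b ,
    λ Y → mk⇔ (λ { (here Y≡) → inj₂ Y≡ ; (there Y∈) → inj₁ (∈-rest⁻ Y∈) })
              (λ { (inj₂ Y≡) → here Y≡ ; (inj₁ (Y∈ , Y≢A , Y≢B)) → there (∈-rest⁺ Y∈ Y≢A Y≢B) })

  point∈A∪B : ∀ v → (if v then p else q) ∈ A ∪ B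
  point∈A∪B true = x∈p∪q⁺ (inj₁ (point∈ pp A∈))
  point∈A∪B false = x∈p∪q⁺ (inj₂ (point∈ pp B∈))

  rest-disjoint : ∀ {Y} → Y ∈L rest → ∀ x → x ∈ A ∪ B → x ∈ proj₁ Y → ⊥
  rest-disjoint Y∈ x x∈A∪B x∈Y with ∈-rest⁻ Y∈ | x∈p∪q⁻ A B x∈A∪B
  ... | Y∈π , Y≢A , _ | inj₁ x∈A = disjoint pp A∈ Y∈π (λ A≡Y → Y≢A (sym A≡Y)) x x∈A x∈Y
  ... | Y∈π , _ , Y≢B | inj₂ x∈B = disjoint pp B∈ Y∈π (λ B≡Y → Y≢B (sym B≡Y)) x x∈B x∈Y

  merged-isPP : IsPP S merged
  point∈ merged-isPP (here refl) = point∈A∪B u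
  point∈ merged-isPP (there Y∈) = point∈ pp (proj₁ (∈-rest⁻ Y∈))
  disjoint merged-isPP (here refl) (here refl) X≢Y = ⊥-elim (X≢Y refl)
  disjoint merged-isPP (here refl) (there Y∈) _ x x∈X x∈Y = rest-disjoint Y∈ x x∈X x∈Y
  disjoint merged-isPP (there X∈) (here refl) _ x x∈X x∈Y = rest-disjoint X∈ x x∈Y x∈X
  disjoint merged-isPP (there X∈) (there Y∈) = disjoint pp (proj₁ (∈-rest⁻ X∈)) (proj₁ (∈-rest⁻ Y∈))
  union merged-isPP x = mk⇔ covered inS
    where
    covered : S x → ∃ λ X → X ∈L merged × x ∈ proj₁ X
    covered x∈S with to (union pp x) x∈S
    ... | X , X∈ , x∈X with X ≟ᵖ (A , p) | X ≟ᵖ (B , q)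
    ... | yes refl | _ = _ , here refl , p⊆p∪q B x∈X
    ... | no _ | yes refl = _ , here refl , q⊆p∪q A B x∈X
    ... | no X≢A | no X≢B = X , there (∈-rest⁺ X∈ X≢A X≢B) , x∈X
    inS : (∃ λ X → X ∈L merged × x ∈ proj₁ X) → S x
    inS (X , here refl , x∈X) with x∈p∪q⁻ A B x∈X
    ... | inj₁ x∈A = from (union pp x) (_ , A∈ , x∈A)
    ... | inj₂ x∈B = from (union pp x) (_ , B∈ , x∈B)
    inS (X , there X∈ , x∈X) = from (union pp x) (X , proj₁ (∈-rest⁻ X∈) , x∈X)

  merged-⊑ : ∀ {π′} → IsPP S π′ → π ⊑ π′ → ∀ {C} → (C , (if u then p else q)) ∈L π′ → A ∪ B ⊆ C →
             merged ⊑ π′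
  merged-⊑ {π′} pp′ (blockBelow , blockAbove) {C} C∈ A∪B⊆C = blockBelow′ , blockAbove′
    where
    viaC : ∀ {E t} → (E , t) ∈L π′ → t ∈ C → ∃ λ D → (D , t) ∈L merged × D ⊆ E
    viaC E∈ t∈C with same-block pp′ E∈ C∈ (point∈ pp′ E∈) t∈C
    ... | refl = A ∪ B , here refl , A∪B⊆C

    blockBelow′ : ∀ {E t} → (E , t) ∈L π′ → ∃ λ D → (D , t) ∈L merged × D ⊆ E
    blockBelow′ {t = t} E∈ with blockBelow E∈
    ... | D , D∈ , D⊆E with (D , t) ≟ᵖ (A , p) | (D , t) ≟ᵖ (B , q)
    ... | yes refl | _ = viaC E∈ (A∪B⊆C (p⊆p∪q B (point∈ pp D∈)))
    ... | no _ | yes refl = viaC E∈ (A∪B⊆C (q⊆p∪q A B (point∈ pp D∈)))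
    ... | no D≢A | no D≢B = D , there (∈-rest⁺ D∈ D≢A D≢B) , D⊆E

    blockAbove′ : ∀ {X} → X ∈L merged → ∃ λ Y → Y ∈L π′ × proj₁ X ⊆ proj₁ Y
    blockAbove′ (here refl) = _ , C∈ , A∪B⊆C
    blockAbove′ (there X∈) = blockAbove (proj₁ (∈-rest⁻ X∈))

CoverBelow : ∀ {n} → (Fin n → Set) → Raw n → Raw n → Set
CoverBelow S π π′ = ∃ λ L → Cover π L × IsPP S L × L ⊑ π′ × length L <ℕ length π

-- A block C of π′ not in π contains the block A of π with the same point and some x ∉ A; the
-- block B of π through x also lies in C, and A, B are merged.
refine-step : ∀ {n} {S : Fin n → Set} {π π′ : Raw n} → IsPP S π → IsPP S π′ → π ⊑ π′ → π ≈ π′ ⊎ CoverBelow S π π′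
refine-step {S = S} {π} {π′} pp pp′ π⊑π′
  with any? (λ X → ¬? (X ∈L? π)) π′
... | no ¬new = inj₁ λ X → mk⇔ (within X) (old X)
  where
  old : ∀ X → X ∈L π′ → X ∈L π
  old X X∈ with X ∈L? π
  ... | yes X∈π = X∈π
  ... | no X∉π = ⊥-elim (¬new (lose X∈ X∉π))
  within : ∀ X → X ∈L π → X ∈L π′
  within X X∈ with proj₂ π⊑π′ X∈
  ... | Y , Y∈ , X⊆Y with same-block pp X∈ (old Y Y∈) (IsPP.point∈ pp X∈) (X⊆Y (IsPP.point∈ pp X∈))
  ... | refl = Y∈
... | yes new with find new
... | (C , r) , C∈ , C∉π with proj₁ π⊑π′ C∈
... | A , A∈ , A⊆C = inj₂ (mergeWith (⊈⇒∃∉ C⊈A))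
  where
  C⊈A : ¬ (C ⊆ A)
  C⊈A C⊆A = C∉π (subst (λ Z → (Z , r) ∈L π) (⊆-antisym A⊆C C⊆A) A∈)

  mergeWith : (∃ λ x → x ∈ C × x ∉ A) → CoverBelow S π π′
  mergeWith (x , x∈C , x∉A) with to (IsPP.union pp x) (from (IsPP.union pp′ x) (_ , C∈ , x∈C))
  ... | (B , q) , B∈ , x∈B = byMinima
    where
    B⊆C : B ⊆ C
    B⊆C with proj₂ π⊑π′ B∈
    ... | Y , Y∈ , B⊆Y with same-block pp′ Y∈ C∈ (B⊆Y x∈B) x∈C
    ... | refl = B⊆Y

    A≢B : (A , r) ≢ (B , q)
    A≢B A≡B = x∉A (subst (λ Z → x ∈ proj₁ Z) (sym A≡B) x∈B)

    ∪⊆C : ∀ {D E} → D ⊆ C → E ⊆ C → D ∪ E ⊆ C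
    ∪⊆C D⊆C E⊆C y∈ with x∈p∪q⁻ _ _ y∈
    ... | inj₁ y∈D = D⊆C y∈D
    ... | inj₂ y∈E = E⊆C y∈E

    byMinima : CoverBelow S π π′
    byMinima with firstIn-nonempty (IsPP.point∈ pp A∈) | firstIn-nonempty (IsPP.point∈ pp B∈)
    ... | a , minA | b , minB with Finₚ.<-cmp a b
    ... | tri< a<b _ _ = let open Merged pp true A∈ B∈ A≢B minA minB a<b
                         in merged , merged-cover , merged-isPP , merged-⊑ pp′ π⊑π′ C∈ (∪⊆C A⊆C B⊆C) ,
                            merged-shorter
    ... | tri> _ _ b<a = let open Merged pp false B∈ A∈ (λ B≡A → A≢B (sym B≡A)) minB minA b<a
                         in merged , merged-cover , merged-isPP , merged-⊑ pp′ π⊑π′ C∈ (∪⊆C B⊆C A⊆C) ,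
                            merged-shorter
    ... | tri≈ _ refl _ = ⊥-elim (A≢B (same-block pp A∈ B∈ (firstIn-∈ minA) (firstIn-∈ minB)))

⊑⇒≤P : ∀ {n} {S : Fin n → Set} {π π′ : Raw n} → IsPP S π → IsPP S π′ → π ⊑ π′ → π ≤P π′
⊑⇒≤P {π = π} pp pp′ π⊑π′ = chain (length π) pp π⊑π′ ℕₚ.≤-refl
  where
  chain : ∀ k {L} → IsPP _ L → L ⊑ _ → length L ≤ℕ k → L ≤P _
  chain k {L} ppL L⊑ len≤ with refine-step ppL pp′ L⊑
  ... | inj₁ L≈ = L , ε , L≈
  ... | inj₂ (L₁ , cover , pp₁ , L₁⊑ , shorter) with k
  ...   | zero = ⊥-elim (ℕₚ.<-irrefl refl (ℕₚ.≤-trans shorter (ℕₚ.≤-trans len≤ z≤n)))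
  ...   | suc k = let L″ , steps , L″≈ = chain k pp₁ L₁⊑ (ℕₚ.≤-pred (ℕₚ.≤-trans shorter len≤))
                  in L″ , cover ◅ steps , L″≈

-- Φ and its inverse, blockwise

∈-ΦSet⁻ : ∀ {n} (β : Raw n) (A : Subset n) {m} → m ∈ ΦSet β A →
          ∃ λ X → X ∈L β × proj₁ X ⊆ A × firstIn (proj₁ X) ≡ just m
∈-ΦSet⁻ [] A m∈ = ⊥-elim (∉⊥ m∈)
∈-ΦSet⁻ ((B , p) ∷ β) A m∈ with B ⊆? A
... | no _ = let X , X∈ , r = ∈-ΦSet⁻ β A m∈ in X , there X∈ , r
... | yes B⊆A with x∈p∪q⁻ (maybeSingleton (firstIn B)) (ΦSet β A) m∈
...   | inj₂ m∈′ = let X , X∈ , r = ∈-ΦSet⁻ β A m∈′ in X , there X∈ , r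
...   | inj₁ m∈⁅⁆ with firstIn B in minB
...     | nothing = ⊥-elim (∉⊥ m∈⁅⁆)
...     | just k = (B , p) , here refl , B⊆A , trans minB (cong just (sym (x∈⁅y⁆⇒x≡y k m∈⁅⁆)))

∈-ΦSet⁺ : ∀ {n} (β : Raw n) (A : Subset n) {X m} →
          X ∈L β → proj₁ X ⊆ A → firstIn (proj₁ X) ≡ just m → m ∈ ΦSet β A
∈-ΦSet⁺ ((B , p) ∷ β) A (here refl) B⊆A minB with B ⊆? A
... | no B⊈A = ⊥-elim (B⊈A B⊆A)
... | yes _ rewrite minB = x∈p∪q⁺ (inj₁ (x∈⁅x⁆ _))
∈-ΦSet⁺ ((B , p) ∷ β) A (there X∈) X⊆A minX with B ⊆? A
... | no _ = ∈-ΦSet⁺ β A X∈ X⊆A minX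
... | yes _ = x∈p∪q⁺ (inj₂ (∈-ΦSet⁺ β A X∈ X⊆A minX))

ΨSet : ∀ {n} → Raw n → Subset n → Subset n
ΨSet [] C = ∅
ΨSet ((B , p) ∷ β) C with firstIn B
... | nothing = ΨSet β C
... | just m with m ∈? C
...   | yes _ = B ∪ ΨSet β C
...   | no _ = ΨSet β C

ΨPoint : ∀ {n} → Raw n → Fin n → Fin n
ΨPoint [] m = m
ΨPoint ((B , p) ∷ β) m with firstIn B
... | nothing = ΨPoint β m
... | just k with k ≟ m
...   | yes _ = p
...   | no _ = ΨPoint β m

∈-ΨSet⁻ : ∀ {n} (β : Raw n) (C : Subset n) {x} → x ∈ ΨSet β C →
          ∃ λ X → X ∈L β × x ∈ proj₁ X × ∃ λ m → firstIn (proj₁ X) ≡ just m × m ∈ C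
∈-ΨSet⁻ [] C x∈ = ⊥-elim (∉⊥ x∈)
∈-ΨSet⁻ ((B , p) ∷ β) C x∈ with firstIn B in minB
... | nothing = let X , X∈ , r = ∈-ΨSet⁻ β C x∈ in X , there X∈ , r
... | just m with m ∈? C
...   | no _ = let X , X∈ , r = ∈-ΨSet⁻ β C x∈ in X , there X∈ , r
...   | yes m∈C with x∈p∪q⁻ B (ΨSet β C) x∈
...     | inj₁ x∈B = (B , p) , here refl , x∈B , m , minB , m∈C
...     | inj₂ x∈′ = let X , X∈ , r = ∈-ΨSet⁻ β C x∈′ in X , there X∈ , r

∈-ΨSet⁺ : ∀ {n} (β : Raw n) (C : Subset n) {X x m} →
          X ∈L β → x ∈ proj₁ X → firstIn (proj₁ X) ≡ just m → m ∈ C → x ∈ ΨSet β C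
∈-ΨSet⁺ ((B , p) ∷ β) C {m = m} (here refl) x∈B minB m∈C rewrite minB with m ∈? C
... | yes _ = x∈p∪q⁺ (inj₁ x∈B)
... | no m∉C = ⊥-elim (m∉C m∈C)
∈-ΨSet⁺ ((B , p) ∷ β) C (there X∈) x∈X minX m∈C with firstIn B
... | nothing = ∈-ΨSet⁺ β C X∈ x∈X minX m∈C
... | just k with k ∈? C
...   | yes _ = x∈p∪q⁺ (inj₂ (∈-ΨSet⁺ β C X∈ x∈X minX m∈C))
...   | no _ = ∈-ΨSet⁺ β C X∈ x∈X minX m∈C

module _ {n} (α : Raw n) (hα : IsPP Full α) where
  open IsPP

  ΦPoint-min : ∀ (β : Raw n) → (∀ {X} → X ∈L β → X ∈L α) →
               ∀ {B q m} → (B , q) ∈L β → firstIn B ≡ just m → ΦPoint β q ≡ m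
  ΦPoint-min ((B′ , p′) ∷ β) β⊆α {B} {q} B∈ minB with p′ ≟ q | firstIn B′ in minB′
  ... | yes refl | just m′
    with same-block hα (β⊆α (here refl)) (β⊆α B∈) (point∈ hα (β⊆α (here refl))) (point∈ hα (β⊆α B∈))
  ...   | refl = just-injective (trans (sym minB′) minB)
  ΦPoint-min ((B′ , p′) ∷ β) β⊆α B∈ minB | yes refl | nothing
    with firstIn-nonempty (point∈ hα (β⊆α (here refl)))
  ...   | k , minB″ with trans (sym minB′) minB″
  ...     | ()
  ΦPoint-min ((B′ , p′) ∷ β) β⊆α (here refl) minB | no p′≢q | _ = ⊥-elim (p′≢q refl)
  ΦPoint-min ((B′ , p′) ∷ β) β⊆α (there B∈) minB | no _ | _ = ΦPoint-min β (λ X∈ → β⊆α (there X∈)) B∈ minB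

  ΨPoint-point : ∀ (β : Raw n) → (∀ {X} → X ∈L β → X ∈L α) →
                 ∀ {B p m} → (B , p) ∈L β → firstIn B ≡ just m → ΨPoint β m ≡ p
  ΨPoint-point ((B′ , p′) ∷ β) β⊆α {m = m} B∈ minB with firstIn B′ in minB′
  ΨPoint-point ((B′ , p′) ∷ β) β⊆α (here refl) minB | nothing with trans (sym minB′) minB
  ... | ()
  ΨPoint-point ((B′ , p′) ∷ β) β⊆α (there B∈) minB | nothing = ΨPoint-point β (λ X∈ → β⊆α (there X∈)) B∈ minB
  ΨPoint-point ((B′ , p′) ∷ β) β⊆α {m = m} B∈ minB | just k with k ≟ m
  ... | yes refl with same-block hα (β⊆α (here refl)) (β⊆α B∈) (firstIn-∈ minB′) (firstIn-∈ minB)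
  ...   | refl = refl
  ΨPoint-point ((B′ , p′) ∷ β) β⊆α (here refl) minB | just k | no k≢m =
    ⊥-elim (k≢m (just-injective (trans (sym minB′) minB)))
  ΨPoint-point ((B′ , p′) ∷ β) β⊆α (there B∈) minB | just k | no _ =
    ΨPoint-point β (λ X∈ → β⊆α (there X∈)) B∈ minB

  ΦPoint-α : ∀ {B q m} → (B , q) ∈L α → firstIn B ≡ just m → ΦPoint α q ≡ m
  ΦPoint-α = ΦPoint-min α (λ X∈ → X∈)

  ΨPoint-α : ∀ {B p m} → (B , p) ∈L α → firstIn B ≡ just m → ΨPoint α m ≡ p
  ΨPoint-α = ΨPoint-point α (λ X∈ → X∈)

  Saturated : Subset n → Set
  Saturated A = ∀ {B p x} → (B , p) ∈L α → x ∈ B → x ∈ A → B ⊆ A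

  record IsUnionOfBlocks (X : PSet n) : Set where
    field
      saturated : Saturated (proj₁ X)
      pointBlock : Subset n
      pointBlock∈ : (pointBlock , proj₂ X) ∈L α
      pointBlock⊆ : pointBlock ⊆ proj₁ X
  open IsUnionOfBlocks

  Above : Raw n → Set
  Above π = IsPP Full π × α ⊑ π

  block-isUnionOfBlocks : ∀ {π} → Above π → ∀ {X} → X ∈L π → IsUnionOfBlocks X
  saturated (block-isUnionOfBlocks (pp , α⊑π) X∈) B∈ x∈B x∈X with proj₂ α⊑π B∈
  ... | Y , Y∈ , B⊆Y with same-block pp X∈ Y∈ x∈X (B⊆Y x∈B)
  ...   | refl = B⊆Y
  pointBlock (block-isUnionOfBlocks (_ , α⊑π) X∈) = proj₁ (proj₁ α⊑π X∈)
  pointBlock∈ (block-isUnionOfBlocks (_ , α⊑π) X∈) = proj₁ (proj₂ (proj₁ α⊑π X∈))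
  pointBlock⊆ (block-isUnionOfBlocks (_ , α⊑π) X∈) = proj₂ (proj₂ (proj₁ α⊑π X∈))

  ΦSet-mono : ∀ {A A′} → A ⊆ A′ → ΦSet α A ⊆ ΦSet α A′
  ΦSet-mono {A} {A′} A⊆A′ m∈ with ∈-ΦSet⁻ α A m∈
  ... | X , X∈ , X⊆A , minX = ∈-ΦSet⁺ α A′ X∈ (⊆-trans X⊆A A⊆A′) minX

  ΦSet-reflects-⊆ : ∀ {D A} → Saturated D → ΦSet α D ⊆ ΦSet α A → D ⊆ A
  ΦSet-reflects-⊆ {D} {A} satD ΦD⊆ΦA {x} x∈D with to (union hα x) tt
  ... | (B , p) , B∈ , x∈B with firstIn-nonempty x∈B
  ... | m , minB with ∈-ΦSet⁻ α A (ΦD⊆ΦA (∈-ΦSet⁺ α D B∈ (satD B∈ x∈B x∈D) minB))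
  ... | X , X∈ , X⊆A , minX with same-block hα B∈ X∈ (firstIn-∈ minB) (firstIn-∈ minX)
  ... | refl = X⊆A x∈B

  ΦPoint-injective : ∀ {X Y} → IsUnionOfBlocks X → IsUnionOfBlocks Y →
                     ΦPoint α (proj₂ X) ≡ ΦPoint α (proj₂ Y) → proj₂ X ≡ proj₂ Y
  ΦPoint-injective uX uY ΦX≡ΦY
    with firstIn-nonempty (point∈ hα (pointBlock∈ uX)) | firstIn-nonempty (point∈ hα (pointBlock∈ uY))
  ... | mX , minX | mY , minY
    with trans (sym (ΦPoint-α (pointBlock∈ uX) minX)) (trans ΦX≡ΦY (ΦPoint-α (pointBlock∈ uY) minY))
  ...   | refl = cong proj₂ (same-block hα (pointBlock∈ uX) (pointBlock∈ uY) (firstIn-∈ minX) (firstIn-∈ minY))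

  ΦPoint-∈-ΦSet : ∀ {X} → IsUnionOfBlocks X → ΦPoint α (proj₂ X) ∈ ΦSet α (proj₁ X)
  ΦPoint-∈-ΦSet {X} uX with firstIn-nonempty (point∈ hα (pointBlock∈ uX))
  ... | m , minB rewrite ΦPoint-α (pointBlock∈ uX) minB = ∈-ΦSet⁺ α (proj₁ X) (pointBlock∈ uX) (pointBlock⊆ uX) minB

  ΦBlock-injective : ∀ {X Y} → IsUnionOfBlocks X → IsUnionOfBlocks Y → ΦBlock α X ≡ ΦBlock α Y → X ≡ Y
  ΦBlock-injective uX uY ΦX≡ΦY =
    cong₂ _,_ (⊆-antisym (ΦSet-reflects-⊆ (saturated uX) (⊆-reflexive (cong proj₁ ΦX≡ΦY)))
                         (ΦSet-reflects-⊆ (saturated uY) (⊆-reflexive (sym (cong proj₁ ΦX≡ΦY)))))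
              (ΦPoint-injective uX uY (cong proj₂ ΦX≡ΦY))

  ΦSet-∪ : ∀ {A B} → Saturated A → Saturated B → ΦSet α (A ∪ B) ≡ ΦSet α A ∪ ΦSet α B
  ΦSet-∪ {A} {B} satA satB = ⊆-antisym split join
    where
    split : ΦSet α (A ∪ B) ⊆ ΦSet α A ∪ ΦSet α B
    split m∈ with ∈-ΦSet⁻ α (A ∪ B) m∈
    ... | X , X∈ , X⊆A∪B , minX with x∈p∪q⁻ A B (X⊆A∪B (firstIn-∈ minX))
    ...   | inj₁ m∈A = x∈p∪q⁺ (inj₁ (∈-ΦSet⁺ α A X∈ (satA X∈ (firstIn-∈ minX) m∈A) minX))
    ...   | inj₂ m∈B = x∈p∪q⁺ (inj₂ (∈-ΦSet⁺ α B X∈ (satB X∈ (firstIn-∈ minX) m∈B) minX))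
    join : ΦSet α A ∪ ΦSet α B ⊆ ΦSet α (A ∪ B)
    join m∈ with x∈p∪q⁻ (ΦSet α A) (ΦSet α B) m∈
    ... | inj₁ m∈ΦA = ΦSet-mono (p⊆p∪q B) m∈ΦA
    ... | inj₂ m∈ΦB = ΦSet-mono (q⊆p∪q A B) m∈ΦB

  -- The α-block through the minimum a of A starts at a, so a itself lands in ΦSet α A.
  ΦSet-preserves-IsMin : ∀ {a A} → Saturated A → IsMin a A → IsMin a (ΦSet α A)
  ΦSet-preserves-IsMin {a} {A} satA (a∈A , a≤) with to (union hα a) tt
  ... | (B , p) , B∈ , a∈B with firstIn-nonempty a∈B
  ... | m , minB with Finₚ.≤-antisym (firstIn-minimal minB a∈B) (a≤ _ (satA B∈ a∈B a∈A (firstIn-∈ minB)))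
  ... | refl = ∈-ΦSet⁺ α A B∈ (satA B∈ a∈B a∈A) minB ,
               λ y y∈ → let X , _ , X⊆A , minX = ∈-ΦSet⁻ α A y∈ in a≤ y (X⊆A (firstIn-∈ minX))

  Φ-isPP : ∀ {π} → Above π → IsPP (MinsOf α) (Φ α π)
  point∈ (Φ-isPP abv) X′∈ with ∈-map⁻ (ΦBlock α) X′∈
  ... | X , X∈ , refl = ΦPoint-∈-ΦSet (block-isUnionOfBlocks abv X∈)
  disjoint (Φ-isPP (pp , _)) X′∈ Y′∈ X′≢Y′ x x∈X′ x∈Y′ with ∈-map⁻ (ΦBlock α) X′∈ | ∈-map⁻ (ΦBlock α) Y′∈
  ... | X , X∈ , refl | Y , Y∈ , refl with ∈-ΦSet⁻ α (proj₁ X) x∈X′ | ∈-ΦSet⁻ α (proj₁ Y) x∈Y′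
  ... | _ , _ , B⊆X , minB | _ , _ , B′⊆Y , minB′ =
    disjoint pp X∈ Y∈ (λ X≡Y → X′≢Y′ (cong (ΦBlock α) X≡Y)) x (B⊆X (firstIn-∈ minB)) (B′⊆Y (firstIn-∈ minB′))
  union (Φ-isPP {π} (_ , α⊑π)) x = mk⇔ covered isMin
    where
    covered : MinsOf α x → ∃ λ X → X ∈L Φ α π × x ∈ proj₁ X
    covered (B , B∈ , x=minB) with proj₂ α⊑π B∈
    ... | Y , Y∈ , B⊆Y = ΦBlock α Y , ∈-map⁺ (ΦBlock α) Y∈ , ∈-ΦSet⁺ α (proj₁ Y) B∈ B⊆Y (IsMin⇒firstIn x=minB)
    isMin : (∃ λ X → X ∈L Φ α π × x ∈ proj₁ X) → MinsOf α x
    isMin (X′ , X′∈ , x∈X′) with ∈-map⁻ (ΦBlock α) X′∈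
    ... | X , X∈ , refl with ∈-ΦSet⁻ α (proj₁ X) x∈X′
    ...   | B , B∈ , _ , minB = B , B∈ , firstIn⇒IsMin minB

  Φ-resp-≈ : ∀ π π′ → π ≈ π′ → Φ α π ≈ Φ α π′
  Φ-resp-≈ π π′ π≈π′ Y = mk⇔ (mapped π≈π′) (mapped (≈-sym π≈π′))
    where
    mapped : ∀ {L L′} → L ≈ L′ → Y ∈L Φ α L → Y ∈L Φ α L′
    mapped L≈L′ Y∈ with ∈-map⁻ (ΦBlock α) Y∈
    ... | X , X∈ , refl = ∈-map⁺ (ΦBlock α) (to (L≈L′ X) X∈)

  Φ-injective : ∀ {π π′} → Above π → Above π′ → Φ α π ≈ Φ α π′ → π ≈ π′
  Φ-injective abv abv′ Φπ≈Φπ′ X = mk⇔ (pulled abv abv′ Φπ≈Φπ′) (pulled abv′ abv (≈-sym Φπ≈Φπ′))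
    where
    pulled : ∀ {L L′} → Above L → Above L′ → Φ α L ≈ Φ α L′ → X ∈L L → X ∈L L′
    pulled abvL abvL′ ΦL≈ΦL′ X∈ with ∈-map⁻ (ΦBlock α) (to (ΦL≈ΦL′ _) (∈-map⁺ (ΦBlock α) X∈))
    ... | Y , Y∈ , ΦX≡ΦY
      with ΦBlock-injective (block-isUnionOfBlocks abvL X∈) (block-isUnionOfBlocks abvL′ Y∈) ΦX≡ΦY
    ...   | refl = Y∈

  Φ-⊑⇔ : ∀ {π π′} → Above π → Above π′ → π ⊑ π′ ⇔ Φ α π ⊑ Φ α π′
  Φ-⊑⇔ {π} {π′} abv abv′ = mk⇔ forth back
    where
    forth : π ⊑ π′ → Φ α π ⊑ Φ α π′
    proj₁ (forth (blockBelow , _)) Y∈ with ∈-map⁻ (ΦBlock α) Y∈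
    ... | _ , X∈ , refl with blockBelow X∈
    ...   | D , D∈ , D⊆ = ΦSet α D , ∈-map⁺ (ΦBlock α) D∈ , ΦSet-mono D⊆
    proj₂ (forth (_ , blockAbove)) X′∈ with ∈-map⁻ (ΦBlock α) X′∈
    ... | _ , X∈ , refl with blockAbove X∈
    ...   | Y , Y∈ , X⊆Y = ΦBlock α Y , ∈-map⁺ (ΦBlock α) Y∈ , ΦSet-mono X⊆Y
    back : Φ α π ⊑ Φ α π′ → π ⊑ π′
    proj₁ (back (blockBelow , _)) {A} A∈ with blockBelow (∈-map⁺ (ΦBlock α) A∈)
    ... | D′ , D′∈ , D′⊆ with ∈-map⁻ (ΦBlock α) D′∈
    ...   | (D , t) , D∈ , D′≡ΦD
      with ΦPoint-injective (block-isUnionOfBlocks abv′ A∈) (block-isUnionOfBlocks abv D∈) (cong proj₂ D′≡ΦD)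
    ...     | refl = D , D∈ , ΦSet-reflects-⊆ (saturated (block-isUnionOfBlocks abv D∈))
                                             (subst (_⊆ ΦSet α A) (cong proj₁ D′≡ΦD) D′⊆)
    proj₂ (back (_ , blockAbove)) X∈ with blockAbove (∈-map⁺ (ΦBlock α) X∈)
    ... | Y′ , Y′∈ , ΦX⊆Y′ with ∈-map⁻ (ΦBlock α) Y′∈
    ...   | Y , Y∈ , refl = Y , Y∈ , ΦSet-reflects-⊆ (saturated (block-isUnionOfBlocks abv X∈)) ΦX⊆Y′

  Φ-≤P⇔ : ∀ {π π′} → Above π → Above π′ → π ≤P π′ ⇔ Φ α π ≤P Φ α π′
  Φ-≤P⇔ abv abv′ =
    mk⇔ (λ π≤π′ → ⊑⇒≤P (Φ-isPP abv) (Φ-isPP abv′) (to (Φ-⊑⇔ abv abv′) (≤P⇒⊑ π≤π′)))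
        (λ Φπ≤Φπ′ → ⊑⇒≤P (proj₁ abv) (proj₁ abv′) (from (Φ-⊑⇔ abv abv′) (≤P⇒⊑ Φπ≤Φπ′)))

  Φ-Merge : ∀ {π π′} → Above π → ∀ {a b u} → Merge π π′ a b u → Merge (Φ α π) (Φ α π′) a b u
  Φ-Merge {π} {π′} abv {a} {b} {u} (A , p , B , q , A∈ , B∈ , a=minA , b=minB , a<b , π′≡) =
    ΦSet α A , ΦPoint α p , ΦSet α B , ΦPoint α q , ∈-map⁺ (ΦBlock α) A∈ , ∈-map⁺ (ΦBlock α) B∈ ,
    ΦSet-preserves-IsMin (saturated uA) a=minA , ΦSet-preserves-IsMin (saturated uB) b=minB , a<b ,
    Φπ′≡
    where
    uA = block-isUnionOfBlocks abv A∈
    uB = block-isUnionOfBlocks abv B∈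

    ΦPoint-if : ∀ v → ΦPoint α (if v then p else q) ≡ (if v then ΦPoint α p else ΦPoint α q)
    ΦPoint-if true = refl
    ΦPoint-if false = refl

    ΦMerged : PSet n
    ΦMerged = ΦSet α A ∪ ΦSet α B , (if u then ΦPoint α p else ΦPoint α q)

    Φ-merged : ΦBlock α (A ∪ B , (if u then p else q)) ≡ ΦMerged
    Φ-merged = cong₂ _,_ (ΦSet-∪ (saturated uA) (saturated uB)) (ΦPoint-if u)

    Φ-≢ : ∀ {Y Z} → Y ∈L π → Z ∈L π → Y ≢ Z → ΦBlock α Y ≢ ΦBlock α Z
    Φ-≢ Y∈ Z∈ Y≢Z ΦY≡ΦZ =
      Y≢Z (ΦBlock-injective (block-isUnionOfBlocks abv Y∈) (block-isUnionOfBlocks abv Z∈) ΦY≡ΦZ)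

    Φπ′≡ : ∀ Y′ → Y′ ∈L Φ α π′ ⇔
                  ((Y′ ∈L Φ α π × Y′ ≢ ΦBlock α (A , p) × Y′ ≢ ΦBlock α (B , q)) ⊎ Y′ ≡ ΦMerged)
    Φπ′≡ Y′ = mk⇔ forth back
      where
      forth : Y′ ∈L Φ α π′ → (Y′ ∈L Φ α π × Y′ ≢ ΦBlock α (A , p) × Y′ ≢ ΦBlock α (B , q)) ⊎ Y′ ≡ ΦMerged
      forth Y′∈ with ∈-map⁻ (ΦBlock α) Y′∈
      ... | Y , Y∈ , refl with to (π′≡ Y) Y∈
      ...   | inj₁ (Y∈π , Y≢A , Y≢B) = inj₁ (∈-map⁺ (ΦBlock α) Y∈π , Φ-≢ Y∈π A∈ Y≢A , Φ-≢ Y∈π B∈ Y≢B)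
      ...   | inj₂ refl = inj₂ Φ-merged
      back : (Y′ ∈L Φ α π × Y′ ≢ ΦBlock α (A , p) × Y′ ≢ ΦBlock α (B , q)) ⊎ Y′ ≡ ΦMerged → Y′ ∈L Φ α π′
      back (inj₁ (Y′∈ , Y′≢ΦA , Y′≢ΦB)) with ∈-map⁻ (ΦBlock α) Y′∈
      ... | Y , Y∈ , refl =
        ∈-map⁺ (ΦBlock α) (from (π′≡ Y) (inj₁ (Y∈ , (λ Y≡A → Y′≢ΦA (cong (ΦBlock α) Y≡A))
                                                   , (λ Y≡B → Y′≢ΦB (cong (ΦBlock α) Y≡B)))))
      back (inj₂ refl) = subst (_∈L Φ α π′) Φ-merged (∈-map⁺ (ΦBlock α) (from (π′≡ _) (inj₂ refl)))

  ΨBlock : PSet n → PSet n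
  ΨBlock (C , m) = ΨSet α C , ΨPoint α m

  module _ (σ : Raw n) (ps : IsPP (MinsOf α) σ) where

    blockWithMin : ∀ {y} → MinsOf α y → ∃ λ X → X ∈L α × firstIn (proj₁ X) ≡ just y
    blockWithMin (X , X∈ , y=minX) = X , X∈ , IsMin⇒firstIn y=minX

    isMinimum : ∀ {C m y} → (C , m) ∈L σ → y ∈ C → MinsOf α y
    isMinimum C∈ y∈C = from (union ps _) (_ , C∈ , y∈C)

    Ψσ : Raw n
    Ψσ = map ΨBlock σ

    Ψσ-isPP : IsPP Full Ψσ
    point∈ Ψσ-isPP X′∈ with ∈-map⁻ ΨBlock X′∈
    ... | (C , m) , C∈ , refl with blockWithMin (isMinimum C∈ (point∈ ps C∈))
    ...   | (B , p) , B∈ , minB rewrite ΨPoint-α B∈ minB = ∈-ΨSet⁺ α C B∈ (point∈ hα B∈) minB (point∈ ps C∈)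
    disjoint Ψσ-isPP X′∈ Y′∈ X′≢Y′ x x∈X′ x∈Y′ with ∈-map⁻ ΨBlock X′∈ | ∈-map⁻ ΨBlock Y′∈
    ... | X , X∈ , refl | Y , Y∈ , refl with ∈-ΨSet⁻ α (proj₁ X) x∈X′ | ∈-ΨSet⁻ α (proj₁ Y) x∈Y′
    ... | B , B∈ , x∈B , k , minB , k∈X | B′ , B′∈ , x∈B′ , k′ , minB′ , k′∈Y
      with same-block hα B∈ B′∈ x∈B x∈B′
    ...   | refl with trans (sym minB) minB′
    ...     | refl = disjoint ps X∈ Y∈ (λ X≡Y → X′≢Y′ (cong ΨBlock X≡Y)) k k∈X k′∈Y
    union Ψσ-isPP x = mk⇔ covered (λ _ → tt)
      where
      covered : Full x → ∃ λ X → X ∈L Ψσ × x ∈ proj₁ X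
      covered _ with to (union hα x) tt
      ... | B , B∈ , x∈B with firstIn-nonempty x∈B
      ...   | k , minB with to (union ps k) (B , B∈ , firstIn⇒IsMin minB)
      ...     | (C , m) , C∈ , k∈C = ΨBlock (C , m) , ∈-map⁺ ΨBlock C∈ , ∈-ΨSet⁺ α C B∈ x∈B minB k∈C

    α⊑Ψσ : α ⊑ Ψσ
    proj₁ α⊑Ψσ X′∈ with ∈-map⁻ ΨBlock X′∈
    ... | (C , k) , C∈ , refl with blockWithMin (isMinimum C∈ (point∈ ps C∈))
    ...   | (B , p) , B∈ , minB = B , subst (λ z → (B , z) ∈L α) (sym (ΨPoint-α B∈ minB)) B∈ ,
                                  (λ x∈B → ∈-ΨSet⁺ α C B∈ x∈B minB (point∈ ps C∈))
    proj₂ α⊑Ψσ {B , p} B∈ with firstIn-nonempty (point∈ hα B∈)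
    ... | k , minB with to (union ps k) ((B , p) , B∈ , firstIn⇒IsMin minB)
    ...   | (C , m) , C∈ , k∈C = ΨBlock (C , m) , ∈-map⁺ ΨBlock C∈ , (λ x∈B → ∈-ΨSet⁺ α C B∈ x∈B minB k∈C)

    ΦΨ≡ : ∀ {X} → X ∈L σ → ΦBlock α (ΨBlock X) ≡ X
    ΦΨ≡ {C , m} C∈ = cong₂ _,_ (⊆-antisym ΦΨC⊆C C⊆ΦΨC) ΦΨm≡m
      where
      ΦΨC⊆C : ΦSet α (ΨSet α C) ⊆ C
      ΦΨC⊆C y∈ with ∈-ΦSet⁻ α (ΨSet α C) y∈
      ... | B , B∈ , B⊆ , minB with ∈-ΨSet⁻ α C (B⊆ (firstIn-∈ minB))
      ...   | B′ , B′∈ , y∈B′ , k , minB′ , k∈C with same-block hα B∈ B′∈ (firstIn-∈ minB) y∈B′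
      ...     | refl with trans (sym minB) minB′
      ...       | refl = k∈C
      C⊆ΦΨC : C ⊆ ΦSet α (ΨSet α C)
      C⊆ΦΨC y∈C with blockWithMin (isMinimum C∈ y∈C)
      ... | B , B∈ , minB = ∈-ΦSet⁺ α (ΨSet α C) B∈ (λ x∈B → ∈-ΨSet⁺ α C B∈ x∈B minB y∈C) minB
      ΦΨm≡m : ΦPoint α (ΨPoint α m) ≡ m
      ΦΨm≡m with blockWithMin (isMinimum C∈ (point∈ ps C∈))
      ... | (B , p) , B∈ , minB rewrite ΨPoint-α B∈ minB = ΦPoint-α B∈ minB

    ΦΨσ≈σ : Φ α Ψσ ≈ σ
    ΦΨσ≈σ Y = mk⇔ forth back
      where
      forth : Y ∈L Φ α Ψσ → Y ∈L σ
      forth Y∈ with ∈-map⁻ (ΦBlock α) Y∈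
      ... | Z , Z∈ , refl with ∈-map⁻ ΨBlock Z∈
      ...   | X , X∈ , refl rewrite ΦΨ≡ X∈ = X∈
      back : Y ∈L σ → Y ∈L Φ α Ψσ
      back Y∈ = subst (_∈L Φ α Ψσ) (ΦΨ≡ Y∈) (∈-map⁺ (ΦBlock α) (∈-map⁺ ΨBlock Y∈))

    Φ-surjective : ∃ λ π → IsPP Full π × α ≤P π × Φ α π ≈ σ
    Φ-surjective = Ψσ , Ψσ-isPP , ⊑⇒≤P hα Ψσ-isPP α⊑Ψσ , ΦΨσ≈σ

lemma2p10 : (n : ℕ) (α : Raw n) → IsPP Full α →
    -- Φ maps U(α) into Π^•_S, S = {min B_1, …, min B_l}
    (∀ π → IsPP Full π → α ≤P π → IsPP (MinsOf α) (Φ α π)) ×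
    -- Φ is well defined on collections
    (∀ π π' → π ≈ π' → Φ α π ≈ Φ α π') ×
    -- injective
    (∀ π π' → IsPP Full π → α ≤P π → IsPP Full π' → α ≤P π' →
       Φ α π ≈ Φ α π' → π ≈ π') ×
    -- surjective
    (∀ σ → IsPP (MinsOf α) σ →
       Σ (Raw n) λ π → IsPP Full π × α ≤P π × Φ α π ≈ σ) ×
    -- order preserving and reflecting
    (∀ π π' → IsPP Full π → α ≤P π → IsPP Full π' → α ≤P π' →
       (π ≤P π') ⇔ (Φ α π ≤P Φ α π')) ×
    -- preserves the labeling λ•
    (∀ π π' → IsPP Full π → α ≤P π → IsPP Full π' → α ≤P π' →
       ∀ (a b : Fin n) (u : Bool) → Merge π π' a b u → Merge (Φ α π) (Φ α π') a b u)
lemma2p10 n α hα =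
  (λ π pp α≤π → Φ-isPP α hα (pp , ≤P⇒⊑ α≤π)) ,
  Φ-resp-≈ α hα ,
  (λ π π′ pp α≤π pp′ α≤π′ → Φ-injective α hα (pp , ≤P⇒⊑ α≤π) (pp′ , ≤P⇒⊑ α≤π′)) ,
  Φ-surjective α hα ,
  (λ π π′ pp α≤π pp′ α≤π′ → Φ-≤P⇔ α hα (pp , ≤P⇒⊑ α≤π) (pp′ , ≤P⇒⊑ α≤π′)) ,
  (λ π π′ pp α≤π _ _ a b u → Φ-Merge α hα (pp , ≤P⇒⊑ α≤π))
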